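{- $\mathrm{ex}'(n,\{\text{taco},\text{nested},\text{crossing}\})\in O(n)$.
   Context: Let $P$ be a set of $n$ points in convex position in the plane (the vertices of a convex $n$-gon); a triangle on $P$ is a 3-element subset of $P$. For two distinct triangles $t_1,t_2$ on $P$, label each point of $t_1\cup t_2$ by the triangle(s) containing it and read the points in their cyclic order around the polygon. The pair forms exactly one of eight configurations. (i) If $t_1,t_2$ share two vertices $u,v$: "taco" if their third vertices lie on the same side of the line $uv$, "mariposa" if on opposite sides. (ii) If they share exactly one vertex $v$: read the remaining four vertices in cyclic order starting just after $v$; "bat" if the pattern is $t_1t_1t_2t_2$ or $t_2t_2t_1t_1$, "nested" if it is $t_1t_2t_2t_1$ or $t_2t_1t_1t_2$, "crossing" if it is $t_1t_2t_1t_2$ or $t_2t_1t_2t_1$. (iii) If they share no vertex, the cyclic sequence of the six labels is, up to rotation, reflection and exchanging the roles of $t_1,t_2$, one of: "ears" $AAABBB$, "swords" $AABABB$, "david" $ABABAB$. Top/bottom variant: partition the vertices of the convex $n$-gon by a horizontal line into a top half of $\lceil n/2\rceil$ vertices and a bottom half of $\lfloor n/2\rfloor$ vertices (each half consisting of consecutive vertices along the polygon). For a set $X$ of configurations, $\mathrm{ex}'(n,X)$ is the maximum size of a family of triangles on $P$, each having exactly two vertices in the top half and one vertex in the bottom half, in which no two triangles form a configuration belonging to $X$. -}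

module Defs where

open import Data.Nat using (ℕ; _+_; _*_; _<_; _≤_; _<ᵇ_; ⌈_/2⌉)
open import Data.Bool using (if_then_else_)
open import Data.Fin using (Fin; toℕ)
open import Data.Fin.Subset using (Subset; _∈_; _∉_; _∩_; ∣_∣)
open import Data.Vec using (tabulate)
open import Data.Product using (_×_; ∃-syntax)
open import Data.Sum using (_⊎_)
open import Relation.Binary.PropositionalEquality using (_≡_)
open import Relation.Nullary using (¬_)

-- Points of P: Fin n, numbered 0,1,...,n-1 in cyclic order around the convex n-gon.
-- A triangle on P: a 3-element subset.
IsTriangle : ∀ {n} → Subset n → Set
IsTriangle t = ∣ t ∣ ≡ 3

top : (n : ℕ) → Subset n
top n = tabulate (λ i → toℕ i <ᵇ ⌈ n /2⌉)

TopBottomTriangle : ∀ n → Subset n → Set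
TopBottomTriangle n t = IsTriangle t × ∣ t ∩ top n ∣ ≡ 2

Between : ∀ {n} → Fin n → Fin n → Fin n → Set
Between u v w = toℕ u < toℕ w × toℕ w < toℕ v

-- Position of x when reading cyclically starting just after v
-- (points after v keep their index, points before-or-at v are shifted by n).
key : ∀ {n} → Fin n → Fin n → ℕ
key {n} v x = if toℕ v <ᵇ toℕ x then toℕ x else toℕ x + n

-- taco: share exactly two vertices u,v; the third vertices w₁,w₂ lie on the
-- same side of the line uv (both on the arc strictly between u and v, or both off it).
Taco : ∀ {n} → Subset n → Subset n → Set
Taco t₁ t₂ = ∣ t₁ ∩ t₂ ∣ ≡ 2 ×
  ∃[ u ] ∃[ v ] ∃[ w₁ ] ∃[ w₂ ]
    (toℕ u < toℕ v × u ∈ t₁ × v ∈ t₁ × u ∈ t₂ × v ∈ t₂ ×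
     w₁ ∈ t₁ × w₁ ∉ t₂ × w₂ ∈ t₂ × w₂ ∉ t₁ ×
     ((Between u v w₁ × Between u v w₂) ⊎ (¬ Between u v w₁ × ¬ Between u v w₂)))

SharesOne : ∀ {n} → Subset n → Subset n → Fin n → Fin n → Fin n → Fin n → Fin n → Set
SharesOne t₁ t₂ v p₁ q₁ p₂ q₂ =
  ∣ t₁ ∩ t₂ ∣ ≡ 1 × v ∈ t₁ × v ∈ t₂ ×
  p₁ ∈ t₁ × p₁ ∉ t₂ × q₁ ∈ t₁ × q₁ ∉ t₂ ×
  p₂ ∈ t₂ × p₂ ∉ t₁ × q₂ ∈ t₂ × q₂ ∉ t₁

-- nested: reading from just after v, pattern t₁t₂t₂t₁ or t₂t₁t₁t₂.
Nested : ∀ {n} → Subset n → Subset n → Set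
Nested t₁ t₂ = ∃[ v ] ∃[ p₁ ] ∃[ q₁ ] ∃[ p₂ ] ∃[ q₂ ]
  (SharesOne t₁ t₂ v p₁ q₁ p₂ q₂ ×
   ((key v p₁ < key v p₂ × key v p₂ < key v q₂ × key v q₂ < key v q₁) ⊎
    (key v p₂ < key v p₁ × key v p₁ < key v q₁ × key v q₁ < key v q₂)))

-- crossing: reading from just after v, pattern t₁t₂t₁t₂ or t₂t₁t₂t₁.
Crossing : ∀ {n} → Subset n → Subset n → Set
Crossing t₁ t₂ = ∃[ v ] ∃[ p₁ ] ∃[ q₁ ] ∃[ p₂ ] ∃[ q₂ ]
  (SharesOne t₁ t₂ v p₁ q₁ p₂ q₂ ×
   ((key v p₁ < key v p₂ × key v p₂ < key v q₁ × key v q₁ < key v q₂) ⊎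
    (key v p₂ < key v p₁ × key v p₁ < key v q₂ × key v q₂ < key v q₁)))

FormsForbidden : ∀ {n} → Subset n → Subset n → Set
FormsForbidden t₁ t₂ = Taco t₁ t₂ ⊎ Nested t₁ t₂ ⊎ Crossing t₁ t₂

module Submission where

-- A triangle t with two vertices in the top half and one in the bottom
-- half has vertices a < b < c (in the cyclic numbering 0,…,n-1), and since the top
-- half is the initial segment 0,…,⌈n/2⌉-1 we get b < ⌈n/2⌉ ≤ c.  Call a the apex of t.
-- Two distinct such triangles with the same apex always form a forbidden pair:
--   * if they also share b (resp. c), they form a taco on the chord ab (resp. ac),
--     the third vertices both lying off (resp. on) the arc of that chord;
--   * otherwise they share only the apex, and reading from just after it the top
--     vertices b, b' come before the bottom vertices c, c', so the pattern is
--     crossing or nested according to how b, b' and c, c' compare.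
-- Hence in a family without forbidden pairs the apex map is injective, and the
-- family has at most n triangles: ex'(n, {taco, nested, crossing}) ≤ n.

open import Defs
open import Data.Nat using (ℕ; suc; _*_; _≤_; _<_; _>_; z<s; s<s; s≤s⁻¹; ⌈_/2⌉)
open import Data.Nat.Properties
  using (<ᵇ⇒<; <⇒<ᵇ; <-irrefl; <-asym; <-trans; <-≤-trans; ≤-trans; ≤-antisym;
         ≤-reflexive; ≰⇒>; <-cmp; *-identityˡ; _≤?_; _<?_)
open import Data.Bool.Properties using (T-≡)
open import Data.Fin using (Fin; toℕ; zero; suc)
open import Data.Fin.Properties using (toℕ-injective; injective⇒≤; <⇒≢) renaming (_≟_ to _≟ᶠ_)
open import Data.Fin.Subset using (Subset; _∩_; ∣_∣; _⊆_; _⊂_; ⁅_⁆; inside; outside)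
  renaming (_∈_ to _∈ₛ_; _∉_ to _∉ₛ_)
open import Data.Fin.Subset.Properties
  using (p⊆q⇒∣p∣≤∣q∣; p⊂q⇒∣p∣<∣q∣; ∣⁅x⁆∣≡1; x∈⁅x⁆; x∈⁅y⁆⇒x≡y; x≢y⇒x∉⁅y⁆;
         x∈p∩q⁺; x∈p∩q⁻; p∩q⊆p; ⊆-antisym)
open import Data.Vec using ([]; _∷_; here; there)
open import Data.Vec.Properties using (lookup⇒[]=; []=⇒lookup; lookup∘tabulate)
open import Data.List using (List; []; _∷_; length; map; lookup)
open import Data.List.Properties using (length-map)
open import Data.List.Membership.Propositional using (_∈_)
open import Data.List.Membership.Propositional.Properties using (∈-map⁺; ∈-map⁻; ∈-lookup)
open import Data.List.Relation.Unary.Any using (here; there)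
open import Data.List.Relation.Unary.All using (All; []; _∷_)
import Data.List.Relation.Unary.All as All
open import Data.List.Relation.Unary.All.Properties using () renaming (map⁺ to All-map⁺)
open import Data.List.Relation.Unary.AllPairs using (AllPairs; []; _∷_)
import Data.List.Relation.Unary.AllPairs as AllPairs
open import Data.List.Relation.Unary.AllPairs.Properties using () renaming (map⁺ to AllPairs-map⁺)
open import Data.List.Relation.Unary.Unique.Propositional using (Unique)
open import Data.Product using (∃-syntax; _×_; _,_; proj₁; proj₂)
open import Data.Sum using (_⊎_; inj₁; inj₂)
open import Data.Empty using (⊥-elim)
open import Function using (_∘_; Equivalence)
open import Relation.Binary.PropositionalEquality
  using (_≡_; _≢_; ≢-sym; refl; sym; trans; cong; subst; subst₂)
open import Relation.Binary.Definitions using (Tri; tri<; tri≈; tri>)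
open import Relation.Nullary using (¬_; yes; no)
open import Relation.Nullary.Decidable using (decidable-stable)

Ascending : ∀ {n} → List (Fin n) → Set
Ascending = AllPairs (λ x y → toℕ x < toℕ y)

elements : ∀ {n} → Subset n → List (Fin n)
elements []            = []
elements (inside  ∷ s) = zero ∷ map suc (elements s)
elements (outside ∷ s) = map suc (elements s)

elements-length : ∀ {n} (s : Subset n) → length (elements s) ≡ ∣ s ∣
elements-length []            = refl
elements-length (inside  ∷ s) = cong suc (trans (length-map suc (elements s)) (elements-length s))
elements-length (outside ∷ s) = trans (length-map suc (elements s)) (elements-length s)

elements-sound : ∀ {n} (s : Subset n) {x} → x ∈ elements s → x ∈ₛ s
elements-sound (inside ∷ s) (here refl) = here
elements-sound (inside ∷ s) (there p) with ∈-map⁻ suc p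
... | _ , q , refl = there (elements-sound s q)
elements-sound (outside ∷ s) p with ∈-map⁻ suc p
... | _ , q , refl = there (elements-sound s q)

elements-complete : ∀ {n} (s : Subset n) {x} → x ∈ₛ s → x ∈ elements s
elements-complete (inside  ∷ s) here      = here refl
elements-complete (inside  ∷ s) (there p) = there (∈-map⁺ suc (elements-complete s p))
elements-complete (outside ∷ s) (there p) = ∈-map⁺ suc (elements-complete s p)

elements-ascending : ∀ {n} (s : Subset n) → Ascending (elements s)
elements-ascending []            = []
elements-ascending (inside  ∷ s) =
  All-map⁺ (All.universal (λ _ → z<s) (elements s)) ∷
  AllPairs-map⁺ (AllPairs.map s<s (elements-ascending s))
elements-ascending (outside ∷ s) = AllPairs-map⁺ (AllPairs.map s<s (elements-ascending s))

record Ascending3 {n} (t : Subset n) : Set where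
  field
    a b c : Fin n
    a<b   : toℕ a < toℕ b
    b<c   : toℕ b < toℕ c
    a∈t   : a ∈ₛ t
    b∈t   : b ∈ₛ t
    c∈t   : c ∈ₛ t
    only  : ∀ {x} → x ∈ₛ t → x ≡ a ⊎ x ≡ b ⊎ x ≡ c

ascending3 : ∀ {n} (t : Subset n) → ∣ t ∣ ≡ 3 → Ascending3 t
ascending3 t ∣t∣≡3 =
  fromList (elements t) (trans (elements-length t) ∣t∣≡3)
           (elements-sound t) (elements-complete t) (elements-ascending t)
  where
  fromList : ∀ xs → length xs ≡ 3 → (∀ {x} → x ∈ xs → x ∈ₛ t) →
             (∀ {x} → x ∈ₛ t → x ∈ xs) → Ascending xs → Ascending3 t
  fromList (a ∷ b ∷ c ∷ []) _ sound complete ((a<b ∷ _ ∷ []) ∷ (b<c ∷ []) ∷ _) = record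
    { a = a ; b = b ; c = c ; a<b = a<b ; b<c = b<c
    ; a∈t = sound (here refl) ; b∈t = sound (there (here refl))
    ; c∈t = sound (there (there (here refl))) ; only = only }
    where
    only : ∀ {x} → x ∈ₛ t → x ≡ a ⊎ x ≡ b ⊎ x ≡ c
    only p with complete p
    ... | here x≡a                 = inj₁ x≡a
    ... | there (here x≡b)         = inj₂ (inj₁ x≡b)
    ... | there (there (here x≡c)) = inj₂ (inj₂ x≡c)
  fromList (_ ∷ _ ∷ _ ∷ _ ∷ _) () _ _ _

top⁺ : ∀ {n} (x : Fin n) → toℕ x < ⌈ n /2⌉ → x ∈ₛ top n
top⁺ {n} x x<half =
  lookup⇒[]= x (top n) (trans (lookup∘tabulate _ x) (Equivalence.to T-≡ (<⇒<ᵇ x<half)))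

top⁻ : ∀ {n} (x : Fin n) → x ∈ₛ top n → toℕ x < ⌈ n /2⌉
top⁻ {n} x x∈top =
  <ᵇ⇒< (toℕ x) ⌈ n /2⌉ (Equivalence.from T-≡ (trans (sym (lookup∘tabulate _ x)) ([]=⇒lookup x∈top)))

record Shape {n} (a : Fin n) (t : Subset n) : Set where
  field
    b c      : Fin n
    a<b      : toℕ a < toℕ b
    b-top    : toℕ b < ⌈ n /2⌉
    c-bottom : ⌈ n /2⌉ ≤ toℕ c
    a∈t      : a ∈ₛ t
    b∈t      : b ∈ₛ t
    c∈t      : c ∈ₛ t
    only     : ∀ {x} → x ∈ₛ t → x ≡ a ⊎ x ≡ b ⊎ x ≡ c

  b<c : toℕ b < toℕ c
  b<c = <-≤-trans b-top c-bottom

  a<c : toℕ a < toℕ c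
  a<c = <-trans a<b b<c

  avoid : ∀ {x} → x ≢ a → x ≢ b → x ≢ c → x ∉ₛ t
  avoid x≢a x≢b x≢c x∈t with only x∈t
  ... | inj₁ x≡a        = x≢a x≡a
  ... | inj₂ (inj₁ x≡b) = x≢b x≡b
  ... | inj₂ (inj₂ x≡c) = x≢c x≡c

>⇒≢ : ∀ {n} {x y : Fin n} → toℕ y < toℕ x → x ≢ y
>⇒≢ y<x = ≢-sym (<⇒≢ y<x)

apex : ∀ {n} (t : Subset n) → TopBottomTriangle n t → Fin n
apex t (∣t∣≡3 , _) = Ascending3.a (ascending3 t ∣t∣≡3)

-- Two-in-top, one-in-bottom forces the middle vertex up and the largest one down:
-- otherwise t ∩ top would be ⊆ {a} (size ≤ 1), resp. all of t (size 3).
shape : ∀ {n} {t : Subset n} (p : TopBottomTriangle n t) → Shape (apex t p) t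
shape {n} {t} (∣t∣≡3 , ∣t∩top∣≡2) = record
  { b = b ; c = c ; a<b = a<b ; b-top = b-top ; c-bottom = c-bottom
  ; a∈t = a∈t ; b∈t = b∈t ; c∈t = c∈t ; only = only }
  where
  open Ascending3 (ascending3 t ∣t∣≡3)

  b-top : toℕ b < ⌈ n /2⌉
  b-top with toℕ b <? ⌈ n /2⌉
  ... | yes b<half = b<half
  ... | no  b≮half = ⊥-elim (<-irrefl refl 2≤1)
    where
    t∩top⊆a : t ∩ top n ⊆ ⁅ a ⁆
    t∩top⊆a {x} x∈ with x∈p∩q⁻ t (top n) x∈
    ... | x∈t , x∈top with only x∈t
    ... | inj₁ refl        = x∈⁅x⁆ a
    ... | inj₂ (inj₁ refl) = ⊥-elim (b≮half (top⁻ x x∈top))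
    ... | inj₂ (inj₂ refl) = ⊥-elim (b≮half (<-trans b<c (top⁻ x x∈top)))
    2≤1 : 2 ≤ 1
    2≤1 = subst₂ _≤_ ∣t∩top∣≡2 (∣⁅x⁆∣≡1 a) (p⊆q⇒∣p∣≤∣q∣ t∩top⊆a)

  c-bottom : ⌈ n /2⌉ ≤ toℕ c
  c-bottom with ⌈ n /2⌉ ≤? toℕ c
  ... | yes half≤c = half≤c
  ... | no  half≰c = ⊥-elim (<-irrefl refl 3≤2)
    where
    c<half : toℕ c < ⌈ n /2⌉
    c<half = ≰⇒> half≰c
    t⊆t∩top : t ⊆ t ∩ top n
    t⊆t∩top {x} x∈t with only x∈t
    ... | inj₁ refl        = x∈p∩q⁺ (x∈t , top⁺ x (<-trans (<-trans a<b b<c) c<half))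
    ... | inj₂ (inj₁ refl) = x∈p∩q⁺ (x∈t , top⁺ x (<-trans b<c c<half))
    ... | inj₂ (inj₂ refl) = x∈p∩q⁺ (x∈t , top⁺ x c<half)
    3≤2 : 3 ≤ 2
    3≤2 = subst₂ _≤_ ∣t∣≡3 ∣t∩top∣≡2 (p⊆q⇒∣p∣≤∣q∣ t⊆t∩top)

⁅x⁆⊆ : ∀ {n} {s : Subset n} {x : Fin n} → x ∈ₛ s → ⁅ x ⁆ ⊆ s
⁅x⁆⊆ {x = x} x∈s y∈⁅x⁆ = subst (_∈ₛ _) (sym (x∈⁅y⁆⇒x≡y x y∈⁅x⁆)) x∈s

∣s∣≡2 : ∀ {n} {s t : Subset n} {x y : Fin n} →
        s ⊂ t → ∣ t ∣ ≡ 3 → x ∈ₛ s → y ∈ₛ s → x ≢ y → ∣ s ∣ ≡ 2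
∣s∣≡2 {s = s} {x = x} {y} s⊂t ∣t∣≡3 x∈s y∈s x≢y = ≤-antisym upper lower
  where
  upper : ∣ s ∣ ≤ 2
  upper = s≤s⁻¹ (subst (∣ s ∣ <_) ∣t∣≡3 (p⊂q⇒∣p∣<∣q∣ s⊂t))
  lower : 2 ≤ ∣ s ∣
  lower = subst (_< ∣ s ∣) (∣⁅x⁆∣≡1 x)
            (p⊂q⇒∣p∣<∣q∣ (⁅x⁆⊆ x∈s , y , y∈s , x≢y⇒x∉⁅y⁆ (≢-sym x≢y)))

∣s∣≡1 : ∀ {n} {s : Subset n} {x : Fin n} → s ⊆ ⁅ x ⁆ → x ∈ₛ s → ∣ s ∣ ≡ 1
∣s∣≡1 {s = s} {x} s⊆⁅x⁆ x∈s = trans (≤-antisym (p⊆q⇒∣p∣≤∣q∣ s⊆⁅x⁆) (p⊆q⇒∣p∣≤∣q∣ (⁅x⁆⊆ x∈s))) (∣⁅x⁆∣≡1 x)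

-- The size condition in the definition of a taco is automatic: two triangles sharing
-- the chord uv, each with a private third vertex on the same side of uv, form a taco.
taco : ∀ {n} {t₁ t₂ : Subset n} {u v w₁ w₂ : Fin n} → ∣ t₁ ∣ ≡ 3 → toℕ u < toℕ v →
       u ∈ₛ t₁ → v ∈ₛ t₁ → u ∈ₛ t₂ → v ∈ₛ t₂ → w₁ ∈ₛ t₁ → w₁ ∉ₛ t₂ → w₂ ∈ₛ t₂ → w₂ ∉ₛ t₁ →
       (Between u v w₁ × Between u v w₂) ⊎ (¬ Between u v w₁ × ¬ Between u v w₂) →
       Taco t₁ t₂
taco {t₁ = t₁} {t₂} {u} {v} {w₁} {w₂} ∣t₁∣≡3 u<v u∈₁ v∈₁ u∈₂ v∈₂ w₁∈₁ w₁∉₂ w₂∈₂ w₂∉₁ side =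
  ∣s∣≡2 (p∩q⊆p t₁ t₂ , w₁ , w₁∈₁ , w₁∉₂ ∘ proj₂ ∘ x∈p∩q⁻ t₁ t₂) ∣t₁∣≡3
        (x∈p∩q⁺ (u∈₁ , u∈₂)) (x∈p∩q⁺ (v∈₁ , v∈₂)) (<⇒≢ u<v) ,
  u , v , w₁ , w₂ , u<v , u∈₁ , v∈₁ , u∈₂ , v∈₂ , w₁∈₁ , w₁∉₂ , w₂∈₂ , w₂∉₁ , side

key-after : ∀ {n} (v x : Fin n) → toℕ v < toℕ x → key v x ≡ toℕ x
key-after v x v<x rewrite Equivalence.to T-≡ (<⇒<ᵇ v<x) = refl

module SameApex {n} {a : Fin n} {t₁ t₂ : Subset n} (∣t₁∣≡3 : ∣ t₁ ∣ ≡ 3)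
                (T₁ : Shape a t₁) (T₂ : Shape a t₂) where

  open Shape T₁ using () renaming (b to b₁; c to c₁; a<b to a<b₁; a<c to a<c₁; b<c to b₁<c₁;
    b-top to b₁-top; c-bottom to c₁-bottom; a∈t to a∈t₁; b∈t to b₁∈t₁; c∈t to c₁∈t₁;
    only to only₁; avoid to avoid₁)
  open Shape T₂ using () renaming (b to b₂; c to c₂; a<b to a<b₂; a<c to a<c₂; b<c to b₂<c₂;
    b-top to b₂-top; c-bottom to c₂-bottom; a∈t to a∈t₂; b∈t to b₂∈t₂; c∈t to c₂∈t₂;
    only to only₂; avoid to avoid₂)

  b₁<c₂ : toℕ b₁ < toℕ c₂
  b₁<c₂ = <-≤-trans b₁-top c₂-bottom

  b₂<c₁ : toℕ b₂ < toℕ c₁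
  b₂<c₁ = <-≤-trans b₂-top c₁-bottom

  same-vertices : b₁ ≡ b₂ → c₁ ≡ c₂ → t₁ ≡ t₂
  same-vertices refl refl = ⊆-antisym (included only₁ a∈t₂ b₂∈t₂ c₂∈t₂) (included only₂ a∈t₁ b₁∈t₁ c₁∈t₁)
    where
    included : ∀ {s t : Subset n} {b c} → (∀ {x} → x ∈ₛ s → x ≡ a ⊎ x ≡ b ⊎ x ≡ c) →
               a ∈ₛ t → b ∈ₛ t → c ∈ₛ t → s ⊆ t
    included only a∈ b∈ c∈ x∈s with only x∈s
    ... | inj₁ refl        = a∈
    ... | inj₂ (inj₁ refl) = b∈
    ... | inj₂ (inj₂ refl) = c∈

  -- Sharing the top vertex: a taco on the chord ab, both bottom vertices off its arc.
  shared-top : b₁ ≡ b₂ → c₁ ≢ c₂ → Taco t₁ t₂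
  shared-top refl c₁≢c₂ =
    taco ∣t₁∣≡3 a<b₁ a∈t₁ b₁∈t₁ a∈t₂ b₂∈t₂ c₁∈t₁ c₁∉t₂ c₂∈t₂ c₂∉t₁
         (inj₂ ((λ (_ , c₁<b₁) → <-asym c₁<b₁ b₁<c₁) , (λ (_ , c₂<b₁) → <-asym c₂<b₁ b₁<c₂)))
    where
    c₁∉t₂ = avoid₂ (>⇒≢ a<c₁) (>⇒≢ b₂<c₁) c₁≢c₂
    c₂∉t₁ = avoid₁ (>⇒≢ a<c₂) (>⇒≢ b₁<c₂) (≢-sym c₁≢c₂)

  -- Sharing the bottom vertex: a taco on the chord ac, both top vertices on its arc.
  shared-bottom : b₁ ≢ b₂ → c₁ ≡ c₂ → Taco t₁ t₂
  shared-bottom b₁≢b₂ refl =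
    taco ∣t₁∣≡3 a<c₁ a∈t₁ c₁∈t₁ a∈t₂ c₂∈t₂ b₁∈t₁ b₁∉t₂ b₂∈t₂ b₂∉t₁
         (inj₁ ((a<b₁ , b₁<c₁) , (a<b₂ , b₂<c₁)))
    where
    b₁∉t₂ = avoid₂ (>⇒≢ a<b₁) b₁≢b₂ (<⇒≢ b₁<c₂)
    b₂∉t₁ = avoid₁ (>⇒≢ a<b₂) (≢-sym b₁≢b₂) (<⇒≢ b₂<c₁)

  -- Sharing only the apex: reading from just after a, the top vertices b₁, b₂ come
  -- before the bottom vertices c₁, c₂, so the pattern is crossing when b₁, b₂ and
  -- c₁, c₂ are in the same order, and nested otherwise.
  apex-only : b₁ ≢ b₂ → c₁ ≢ c₂ → Nested t₁ t₂ ⊎ Crossing t₁ t₂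
  apex-only b₁≢b₂ c₁≢c₂ = by-order (<-cmp (toℕ b₁) (toℕ b₂)) (<-cmp (toℕ c₁) (toℕ c₂))
    where
    b₁∉t₂ = avoid₂ (>⇒≢ a<b₁) b₁≢b₂ (<⇒≢ b₁<c₂)
    b₂∉t₁ = avoid₁ (>⇒≢ a<b₂) (≢-sym b₁≢b₂) (<⇒≢ b₂<c₁)
    c₁∉t₂ = avoid₂ (>⇒≢ a<c₁) (>⇒≢ b₂<c₁) c₁≢c₂
    c₂∉t₁ = avoid₁ (>⇒≢ a<c₂) (>⇒≢ b₁<c₂) (≢-sym c₁≢c₂)

    t₁∩t₂⊆⁅a⁆ : t₁ ∩ t₂ ⊆ ⁅ a ⁆
    t₁∩t₂⊆⁅a⁆ x∈ with x∈p∩q⁻ t₁ t₂ x∈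
    ... | x∈t₁ , x∈t₂ with only₁ x∈t₁
    ... | inj₁ refl        = x∈⁅x⁆ a
    ... | inj₂ (inj₁ refl) = ⊥-elim (b₁∉t₂ x∈t₂)
    ... | inj₂ (inj₂ refl) = ⊥-elim (c₁∉t₂ x∈t₂)

    shares : SharesOne t₁ t₂ a b₁ c₁ b₂ c₂
    shares = ∣s∣≡1 t₁∩t₂⊆⁅a⁆ (x∈p∩q⁺ (a∈t₁ , a∈t₂)) , a∈t₁ , a∈t₂ ,
             b₁∈t₁ , b₁∉t₂ , c₁∈t₁ , c₁∉t₂ , b₂∈t₂ , b₂∉t₁ , c₂∈t₂ , c₂∉t₁

    read : ∀ {x y} → toℕ a < toℕ x → toℕ a < toℕ y → toℕ x < toℕ y → key a x < key a y
    read {x} {y} a<x a<y = subst₂ _<_ (sym (key-after a x a<x)) (sym (key-after a y a<y))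

    by-order : Tri (toℕ b₁ < toℕ b₂) (toℕ b₁ ≡ toℕ b₂) (toℕ b₁ > toℕ b₂) →
               Tri (toℕ c₁ < toℕ c₂) (toℕ c₁ ≡ toℕ c₂) (toℕ c₁ > toℕ c₂) →
               Nested t₁ t₂ ⊎ Crossing t₁ t₂
    by-order (tri≈ _ b₁≡b₂ _) _ = ⊥-elim (b₁≢b₂ (toℕ-injective b₁≡b₂))
    by-order _ (tri≈ _ c₁≡c₂ _) = ⊥-elim (c₁≢c₂ (toℕ-injective c₁≡c₂))
    by-order (tri< b₁<b₂ _ _) (tri< c₁<c₂ _ _) = inj₂ (a , b₁ , c₁ , b₂ , c₂ , shares ,
      inj₁ (read a<b₁ a<b₂ b₁<b₂ , read a<b₂ a<c₁ b₂<c₁ , read a<c₁ a<c₂ c₁<c₂))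
    by-order (tri< b₁<b₂ _ _) (tri> _ _ c₂<c₁) = inj₁ (a , b₁ , c₁ , b₂ , c₂ , shares ,
      inj₁ (read a<b₁ a<b₂ b₁<b₂ , read a<b₂ a<c₂ b₂<c₂ , read a<c₂ a<c₁ c₂<c₁))
    by-order (tri> _ _ b₂<b₁) (tri< c₁<c₂ _ _) = inj₁ (a , b₁ , c₁ , b₂ , c₂ , shares ,
      inj₂ (read a<b₂ a<b₁ b₂<b₁ , read a<b₁ a<c₁ b₁<c₁ , read a<c₁ a<c₂ c₁<c₂))
    by-order (tri> _ _ b₂<b₁) (tri> _ _ c₂<c₁) = inj₂ (a , b₁ , c₁ , b₂ , c₂ , shares ,
      inj₂ (read a<b₂ a<b₁ b₂<b₁ , read a<b₁ a<c₂ b₁<c₂ , read a<c₂ a<c₁ c₂<c₁))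

  forbidden : t₁ ≢ t₂ → FormsForbidden t₁ t₂
  forbidden t₁≢t₂ with b₁ ≟ᶠ b₂ | c₁ ≟ᶠ c₂
  ... | yes b₁≡b₂ | yes c₁≡c₂ = ⊥-elim (t₁≢t₂ (same-vertices b₁≡b₂ c₁≡c₂))
  ... | yes b₁≡b₂ | no  c₁≢c₂ = inj₁ (shared-top b₁≡b₂ c₁≢c₂)
  ... | no  b₁≢b₂ | yes c₁≡c₂ = inj₁ (shared-bottom b₁≢b₂ c₁≡c₂)
  ... | no  b₁≢b₂ | no  c₁≢c₂ = inj₂ (apex-only b₁≢b₂ c₁≢c₂)

same-apex⇒forbidden : ∀ {n} {t₁ t₂ : Subset n} (p₁ : TopBottomTriangle n t₁) (p₂ : TopBottomTriangle n t₂) →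
                      apex t₁ p₁ ≡ apex t₂ p₂ → t₁ ≢ t₂ → FormsForbidden t₁ t₂
same-apex⇒forbidden {t₂ = t₂} p₁ p₂ same =
  SameApex.forbidden (proj₁ p₁) (shape p₁) (subst (λ a → Shape a t₂) (sym same) (shape p₂))

lookup-injective : ∀ {A : Set} {xs : List A} → Unique xs → ∀ {i j} → lookup xs i ≡ lookup xs j → i ≡ j
lookup-injective (_ ∷ _) {zero} {zero} _ = refl
lookup-injective (x∉ ∷ _) {zero} {suc j} x≡xⱼ = ⊥-elim (All.lookup x∉ (∈-lookup j) x≡xⱼ)
lookup-injective (x∉ ∷ _) {suc i} {zero} xᵢ≡x = ⊥-elim (All.lookup x∉ (∈-lookup i) (sym xᵢ≡x))
lookup-injective (_ ∷ unique) {suc i} {suc j} xᵢ≡xⱼ = cong suc (lookup-injective unique xᵢ≡xⱼ)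

labelled-length≤ : ∀ {A : Set} {P : A → Set} {n} (xs : List A) → Unique xs → All P xs →
                   (label : ∀ {x} → P x → Fin n) →
                   (∀ {x y} → x ∈ xs → y ∈ xs → (p : P x) (q : P y) → label p ≡ label q → ¬ x ≢ y) →
                   length xs ≤ n
labelled-length≤ {n = n} xs unique ps label distinct = injective⇒≤ label-injective
  where
  labelAt : Fin (length xs) → Fin n
  labelAt i = label (All.lookup ps (∈-lookup i))
  label-injective : ∀ {i j} → labelAt i ≡ labelAt j → i ≡ j
  label-injective {i} {j} same = decidable-stable (i ≟ᶠ j) λ i≢j →
    distinct (∈-lookup i) (∈-lookup j) _ _ same (i≢j ∘ lookup-injective unique)

theorem5 : ∃[ C ] ∃[ N ] ((n : ℕ) → N ≤ n → (F : List (Subset n)) → Unique F →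
             All (TopBottomTriangle n) F →
             ((t₁ t₂ : Subset n) → t₁ ∈ F → t₂ ∈ F → t₁ ≢ t₂ → ¬ FormsForbidden t₁ t₂) →
             length F ≤ C * n)
theorem5 = 1 , 0 , λ n _ F unique triangles free →
  ≤-trans (labelled-length≤ F unique triangles (λ {t} → apex t)
             (λ t₁∈F t₂∈F p₁ p₂ same t₁≢t₂ → free _ _ t₁∈F t₂∈F t₁≢t₂ (same-apex⇒forbidden p₁ p₂ same t₁≢t₂)))
          (≤-reflexive (sym (*-identityˡ n)))
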